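{- Let $p\ge 3$ be a prime. For $m\in\{1,-1\}$ define integers $d_m(n)$ by $$\frac{1}{(1-x)^{m}}\prod_{i=0}^{\infty}\frac{1}{(1-x^{p^{i}})^{(p-1)m}}=\sum_{n=0}^{\infty}d_{m}(n)x^{n}.$$ (For $n\ge 1$ both $d_1(n)$ and $d_{ -1}(n)$ are divisible by $p$.) For $n\ge 1$ let $y_p(n)\in\mathbb{Z}/p\mathbb{Z}$ be the residue of $d_1(n)/p$ modulo $p$ and $z_p(n)\in\mathbb{Z}/p\mathbb{Z}$ the residue of $d_{ -1}(n)/p$ modulo $p$. Then both sequences $(y_p(n))_{n\ge 1}$ and $(z_p(n))_{n\ge1}$ are $p$-automatic.
   Context: A sequence $(e_n)_{n\ge 0}$ is $k$-automatic ($k\ge 2$) if its $k$-kernel $\{(e_{k^in+j})_{n\ge 0}: i\ge 0,\ 0\le j<k^i\}$ is finite; a sequence indexed by $n\ge 1$ is called $k$-automatic if its shift $(e_{n+1})_{n\ge 0}$ is. In the paper, $y_p(n)$ is defined as the residue of $d_m(n)/(pm)$ for any $m>0$ and $z_p(n)$ as the residue of $-d_m(n)/(pm)$ for any $m<0$; taking $m=1$ and $m=-1$ gives the definitions above. -}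

module Defs where

open import Data.Nat as ℕ using (ℕ; zero; suc; _∸_; _^_; _<_; _≡ᵇ_)
open import Data.Nat.Divisibility using (_∣?_)
open import Data.Integer as ℤ using (ℤ; +_; -[1+_])
open import Data.Integer.DivMod using (_/ℕ_; _%ℕ_)
open import Data.List using (List; foldr; map; upTo)
open import Data.List.Relation.Unary.Any using (Any)
open import Data.Bool using (if_then_else_)
open import Data.Product using (Σ)
open import Relation.Nullary.Decidable using (⌊_⌋)
open import Relation.Binary.PropositionalEquality using (_≡_)

Series : Set
Series = ℕ → ℤ

one : Series
one n = if n ≡ᵇ 0 then + 1 else + 0

_⊛_ : Series → Series → Series
(f ⊛ g) n = foldr ℤ._+_ (+ 0) (map (λ k → f k ℤ.* g (n ∸ k)) (upTo (suc n)))

pow : Series → ℕ → Series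
pow f zero = one
pow f (suc k) = f ⊛ pow f k

prodBelow : (ℕ → Series) → ℕ → Series
prodBelow F zero = one
prodBelow F (suc N) = F N ⊛ prodBelow F N

-- 1/(1 - x^q) = Σ_k x^{qk}   (used with q ≥ 1)
geom : ℕ → Series
geom q n = if ⌊ q ∣? n ⌋ then + 1 else + 0

-- 1 - x^q   (used with q ≥ 1)
lin : ℕ → Series
lin q n = if n ≡ᵇ 0 then + 1 else (if n ≡ᵇ q then -[1+ 0 ] else + 0)

-- Factors with p^i > n are ≡ 1 mod x^{n+1}, so the product over i ≤ n
-- (p^i ≥ 2^i > i when p ≥ 2) gives the coefficient of the infinite product.
d₁ : ℕ → ℕ → ℤ
d₁ p n = (geom 1 ⊛ prodBelow (λ i → pow (geom (p ^ i)) (p ∸ 1)) (suc n)) n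

d₋₁ : ℕ → ℕ → ℤ
d₋₁ p n = (lin 1 ⊛ prodBelow (λ i → pow (lin (p ^ i)) (p ∸ 1)) (suc n)) n

resDiv : ℕ → ℤ → ℕ
resDiv zero d = 0
resDiv (suc k) d = (d /ℕ suc k) %ℕ suc k

y : ℕ → ℕ → ℕ
y p n = resDiv p (d₁ p n)

z : ℕ → ℕ → ℕ
z p n = resDiv p (d₋₁ p n)

-- k-automatic: the k-kernel {n ↦ e (k^i n + j) | i ≥ 0, 0 ≤ j < k^i} is finite,
-- i.e. there is a finite list of sequences containing (up to pointwise
-- equality) every kernel element.
IsAutomatic : {A : Set} → ℕ → (ℕ → A) → Set
IsAutomatic {A} k e =
  Σ (List (ℕ → A)) λ L →
    ∀ (i j : ℕ) → j < k ^ i →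
      Any (λ s → ∀ (n : ℕ) → e (k ^ i ℕ.* n ℕ.+ j) ≡ s n) L

-- A sequence indexed by n ≥ 1 is k-automatic iff its shift is.
IsAutomatic₁ : {A : Set} → ℕ → (ℕ → A) → Set
IsAutomatic₁ k e = IsAutomatic k (λ n → e (suc n))

module Submission where

-- Let A(x) be 1/(1-x) (for y) or 1-x (for z) and X_N(x) = A(x) ∏_{i<N} A(x^{p^i})^{p-1}, so that
-- d(n) is the coefficient of x^n in X_{n+1}.  Then X_{N+1}(x) = B(x) X_N(x^p) with
-- B = A(x)^p / A(x^p).  For an odd prime p, (1-x)^p = 1 - x^p + p R(x) with R(0) = 0 and
-- deg R < p, hence B = 1 + p E where E is p-periodic modulo p and E(0) ≡ 0.  Reading the
-- recursion modulo p^2 gives d(pm) ≡ d(m) and d(r + pm) ≡ d(r) for 0 < r < p, so the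
-- p-kernel of the shifted sequence consists of the sequence itself and constants.

open import Defs
open import Data.Nat as ℕ using (ℕ; zero; suc; _∸_; _^_; _%_; _/_; _≡ᵇ_; _≤_; _<_; _≤?_; z≤n; s≤s)
import Data.Nat.Properties as ℕP
open import Data.Nat.DivMod using (m≡m%n+[m/n]*n; m%n<n; m*n%n≡0; m*n/n≡m; [m+kn]%n≡m%n; m<n⇒m%n≡m; m<n*o⇒m/o<n)
open import Data.Nat.Divisibility as ℕD using (_∣?_; _∣_; divides)
open import Data.Nat.Divisibility.Core using (hasNonTrivialDivisor)
open import Data.Nat.Primality using (Prime; euclidsLemma)
import Data.Nat.Tactic.RingSolver as ℕ-Solver
open import Data.Integer as ℤ using (ℤ; +_; -[1+_]; _+_; _*_; -_; _-_; ∣_∣; -1ℤ; 1ℤ; _/ℕ_; _%ℕ_; +<+)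
import Data.Integer.Properties as ℤP
open import Data.Integer.DivMod using (a≡a%ℕn+[a/ℕn]*n; n%ℕd<d)
open import Data.Integer.Tactic.RingSolver using (solve-∀)
open import Data.Bool using (true; false; if_then_else_)
open import Data.List using (List; _∷_; foldr; map; applyUpTo; upTo)
open import Data.List.Membership.Propositional using (lose)
open import Data.List.Membership.Propositional.Properties using (∈-upTo⁺)
open import Data.List.Relation.Unary.Any as Any using (Any; here; there)
open import Data.List.Relation.Unary.Any.Properties using (map⁺)
open import Data.Product using (Σ; _×_; _,_; proj₁; proj₂)
open import Data.Sum using (_⊎_; inj₁; inj₂)
open import Data.Empty using (⊥-elim)
open import Function using (_∘_)
open import Level using (0ℓ)
open import Relation.Nullary using (yes; no; ¬_)
open import Relation.Binary.Bundles using (Setoid)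
open import Relation.Binary.Structures using (IsEquivalence)
open import Relation.Binary.Definitions using (tri<; tri≈; tri>)
open import Relation.Binary.PropositionalEquality

sum< : (ℕ → ℤ) → ℕ → ℤ
sum< h zero    = + 0
sum< h (suc m) = h 0 + sum< (h ∘ suc) m

sum<-cong : ∀ {h h'} m → (∀ k → k < m → h k ≡ h' k) → sum< h m ≡ sum< h' m
sum<-cong zero    e = refl
sum<-cong (suc m) e = cong₂ _+_ (e 0 (s≤s z≤n)) (sum<-cong m (λ k k<m → e (suc k) (s≤s k<m)))

sum<-zero : ∀ {h} m → (∀ k → k < m → h k ≡ + 0) → sum< h m ≡ + 0
sum<-zero zero    e = refl
sum<-zero (suc m) e = cong₂ _+_ (e 0 (s≤s z≤n)) (sum<-zero m (λ k k<m → e (suc k) (s≤s k<m)))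

sum<-head : ∀ {h} m → 0 < m → (∀ k → 0 < k → k < m → h k ≡ + 0) → sum< h m ≡ h 0
sum<-head {h} (suc m) _ rest =
  trans (cong (_+_ (h 0)) (sum<-zero m λ k k<m → rest (suc k) (s≤s z≤n) (s≤s k<m))) (ℤP.+-identityʳ (h 0))

sum<-+ : ∀ h h' m → sum< (λ k → h k + h' k) m ≡ sum< h m + sum< h' m
sum<-+ h h' zero    = refl
sum<-+ h h' (suc m) rewrite sum<-+ (h ∘ suc) (h' ∘ suc) m =
  interchange (h 0) (h' 0) (sum< (h ∘ suc) m) (sum< (h' ∘ suc) m)
  where
  interchange : ∀ a b c d → a + b + (c + d) ≡ a + c + (b + d)
  interchange = solve-∀

sum<-*ˡ : ∀ c h m → sum< (λ k → c * h k) m ≡ c * sum< h m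
sum<-*ˡ c h zero    = sym (ℤP.*-zeroʳ c)
sum<-*ˡ c h (suc m) rewrite sum<-*ˡ c (h ∘ suc) m = sym (ℤP.*-distribˡ-+ c (h 0) _)

sum<-last : ∀ h m → sum< h (suc m) ≡ sum< h m + h m
sum<-last h zero    = ℤP.+-comm (h 0) (+ 0)
sum<-last h (suc m) rewrite sum<-last (h ∘ suc) m = sym (ℤP.+-assoc (h 0) _ _)

sum<-reverse : ∀ h m → sum< h (suc m) ≡ sum< (λ k → h (m ∸ k)) (suc m)
sum<-reverse h zero    = refl
sum<-reverse h (suc m) = begin
  h 0 + sum< (h ∘ suc) (suc m)                                  ≡⟨ cong (_+_ (h 0)) (sum<-reverse (h ∘ suc) m) ⟩
  h 0 + sum< (λ k → h (suc (m ∸ k))) (suc m)                    ≡⟨ ℤP.+-comm (h 0) _ ⟩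
  sum< (λ k → h (suc (m ∸ k))) (suc m) + h 0                    ≡⟨ cong₂ _+_ (sum<-cong (suc m) λ k k≤m → cong h (suc∸ k≤m))
                                                                             (cong h (sym (ℕP.n∸n≡0 m))) ⟩
  sum< (λ k → h (suc m ∸ k)) (suc m) + h (suc m ∸ suc m)         ≡⟨ sym (sum<-last (λ k → h (suc m ∸ k)) (suc m)) ⟩
  sum< (λ k → h (suc m ∸ k)) (suc (suc m))                       ∎
  where
  open ≡-Reasoning
  suc∸ : ∀ {k} → suc k ≤ suc m → suc (m ∸ k) ≡ suc m ∸ k
  suc∸ k≤m = sym (ℕP.+-∸-assoc 1 (ℕP.≤-pred k≤m))

infixl 6 _⊕_
infixl 7 _·_

_⊕_ : Series → Series → Series
(f ⊕ g) n = f n + g n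

_·_ : ℤ → Series → Series
(c · f) n = c * f n

tail : Series → Series
tail f n = f (suc n)

0ₛ : Series
0ₛ _ = + 0

foldr-applyUpTo : ∀ h (s : ℕ → ℕ) m → foldr _+_ (+ 0) (map h (applyUpTo s m)) ≡ sum< (h ∘ s) m
foldr-applyUpTo h s zero    = refl
foldr-applyUpTo h s (suc m) = cong (_+_ (h (s 0))) (foldr-applyUpTo h (s ∘ suc) m)

⊛-unfold : ∀ f g n → (f ⊛ g) n ≡ sum< (λ k → f k * g (n ∸ k)) (suc n)
⊛-unfold f g n = foldr-applyUpTo (λ k → f k * g (n ∸ k)) (λ k → k) (suc n)

⊛-at-zero : ∀ f g → (f ⊛ g) 0 ≡ f 0 * g 0
⊛-at-zero f g = ℤP.+-identityʳ _

⊛-at-suc : ∀ f g n → (f ⊛ g) (suc n) ≡ f 0 * g (suc n) + (tail f ⊛ g) n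
⊛-at-suc f g n = trans (⊛-unfold f g (suc n)) (cong (_+_ (f 0 * g (suc n))) (sym (⊛-unfold (tail f) g n)))

tail-⊛ : ∀ f g → tail (f ⊛ g) ≗ tail f ⊛ g ⊕ f 0 · tail g
tail-⊛ f g n = trans (⊛-at-suc f g n) (ℤP.+-comm (f 0 * g (suc n)) _)

⊛-congˡ : ∀ {f f'} g → f ≗ f' → f ⊛ g ≗ f' ⊛ g
⊛-congˡ {f} {f'} g e n =
  trans (⊛-unfold f g n) (trans (sum<-cong (suc n) λ k _ → cong (_* g (n ∸ k)) (e k)) (sym (⊛-unfold f' g n)))

⊛-congʳ-upTo : ∀ f {g g'} n → (∀ k → k ≤ n → g k ≡ g' k) → (f ⊛ g) n ≡ (f ⊛ g') n
⊛-congʳ-upTo f {g} {g'} n g≡g' = trans (⊛-unfold f g n)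
  (trans (sum<-cong (suc n) λ k _ → cong (f k *_) (g≡g' (n ∸ k) (ℕP.m∸n≤m n k))) (sym (⊛-unfold f g' n)))

⊛-congʳ : ∀ f {g g'} → g ≗ g' → f ⊛ g ≗ f ⊛ g'
⊛-congʳ f g≗g' n = ⊛-congʳ-upTo f n (λ k _ → g≗g' k)

⊛-cong : ∀ {f f' g g'} → f ≗ f' → g ≗ g' → f ⊛ g ≗ f' ⊛ g'
⊛-cong {f} {f'} {g} {g'} e e' n = trans (⊛-congˡ g e n) (⊛-congʳ f' e' n)

⊛-comm : ∀ f g → f ⊛ g ≗ g ⊛ f
⊛-comm f g n = begin
  (f ⊛ g) n                                      ≡⟨ ⊛-unfold f g n ⟩
  sum< (λ k → f k * g (n ∸ k)) (suc n)            ≡⟨ sum<-reverse (λ k → f k * g (n ∸ k)) n ⟩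
  sum< (λ k → f (n ∸ k) * g (n ∸ (n ∸ k))) (suc n) ≡⟨ sum<-cong (suc n) (λ k k<1+n → swap k (ℕP.≤-pred k<1+n)) ⟩
  sum< (λ k → g k * f (n ∸ k)) (suc n)            ≡⟨ sym (⊛-unfold g f n) ⟩
  (g ⊛ f) n                                      ∎
  where
  open ≡-Reasoning
  swap : ∀ k → k ≤ n → f (n ∸ k) * g (n ∸ (n ∸ k)) ≡ g k * f (n ∸ k)
  swap k k≤n = trans (cong (λ j → f (n ∸ k) * g j) (ℕP.m∸[m∸n]≡n k≤n)) (ℤP.*-comm (f (n ∸ k)) (g k))

⊛-distribʳ-⊕ : ∀ h f g → (f ⊕ g) ⊛ h ≗ f ⊛ h ⊕ g ⊛ h
⊛-distribʳ-⊕ h f g n = begin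
  ((f ⊕ g) ⊛ h) n                      ≡⟨ ⊛-unfold (f ⊕ g) h n ⟩
  sum< (λ k → (f k + g k) * h (n ∸ k)) (suc n)
                                       ≡⟨ sum<-cong (suc n) (λ k _ → ℤP.*-distribʳ-+ (h (n ∸ k)) (f k) (g k)) ⟩
  sum< (λ k → fh k + gh k) (suc n)     ≡⟨ sum<-+ fh gh (suc n) ⟩
  sum< fh (suc n) + sum< gh (suc n)    ≡⟨ sym (cong₂ _+_ (⊛-unfold f h n) (⊛-unfold g h n)) ⟩
  (f ⊛ h ⊕ g ⊛ h) n                    ∎
  where
  open ≡-Reasoning
  fh gh : ℕ → ℤ
  fh k = f k * h (n ∸ k)
  gh k = g k * h (n ∸ k)

⊛-distribˡ-⊕ : ∀ h f g → h ⊛ (f ⊕ g) ≗ h ⊛ f ⊕ h ⊛ g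
⊛-distribˡ-⊕ h f g n =
  trans (⊛-comm h (f ⊕ g) n) (trans (⊛-distribʳ-⊕ h f g n) (cong₂ _+_ (⊛-comm f h n) (⊛-comm g h n)))

⊛-·-assocˡ : ∀ c f g → (c · f) ⊛ g ≗ c · (f ⊛ g)
⊛-·-assocˡ c f g n = begin
  ((c · f) ⊛ g) n                          ≡⟨ ⊛-unfold (c · f) g n ⟩
  sum< (λ k → c * f k * g (n ∸ k)) (suc n)   ≡⟨ sum<-cong (suc n) (λ k _ → ℤP.*-assoc c (f k) (g (n ∸ k))) ⟩
  sum< (λ k → c * (f k * g (n ∸ k))) (suc n) ≡⟨ sum<-*ˡ c (λ k → f k * g (n ∸ k)) (suc n) ⟩
  c * sum< (λ k → f k * g (n ∸ k)) (suc n)   ≡⟨ sym (cong (c *_) (⊛-unfold f g n)) ⟩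
  (c · (f ⊛ g)) n                          ∎
  where open ≡-Reasoning

⊛-·-assocʳ : ∀ c f g → f ⊛ (c · g) ≗ c · (f ⊛ g)
⊛-·-assocʳ c f g n =
  trans (⊛-comm f (c · g) n) (trans (⊛-·-assocˡ c g f n) (cong (c *_) (⊛-comm g f n)))

⊛-assoc : ∀ f g h → (f ⊛ g) ⊛ h ≗ f ⊛ (g ⊛ h)
⊛-assoc f g h zero = begin
  ((f ⊛ g) ⊛ h) 0     ≡⟨ trans (⊛-at-zero (f ⊛ g) h) (cong (_* h 0) (⊛-at-zero f g)) ⟩
  f 0 * g 0 * h 0     ≡⟨ ℤP.*-assoc (f 0) (g 0) (h 0) ⟩
  f 0 * (g 0 * h 0)   ≡⟨ sym (trans (⊛-at-zero f (g ⊛ h)) (cong (f 0 *_) (⊛-at-zero g h))) ⟩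
  (f ⊛ (g ⊛ h)) 0     ∎
  where open ≡-Reasoning
⊛-assoc f g h (suc n) = begin
  ((f ⊛ g) ⊛ h) (suc n)                                              ≡⟨ ⊛-at-suc (f ⊛ g) h n ⟩
  (f ⊛ g) 0 * h (suc n) + (tail (f ⊛ g) ⊛ h) n                        ≡⟨ cong₂ _+_ (cong (_* h (suc n)) (⊛-at-zero f g))
                                                                                   (⊛-congˡ h (tail-⊛ f g) n) ⟩
  f 0 * g 0 * h (suc n) + ((tail f ⊛ g ⊕ f 0 · tail g) ⊛ h) n          ≡⟨ cong (_+_ (f 0 * g 0 * h (suc n)))
                                                                           (trans (⊛-distribʳ-⊕ h (tail f ⊛ g) (f 0 · tail g) n)
                                                                                  (cong₂ _+_ (⊛-assoc (tail f) g h n)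
                                                                                             (⊛-·-assocˡ (f 0) (tail g) h n))) ⟩
  f 0 * g 0 * h (suc n) + ((tail f ⊛ (g ⊛ h)) n + f 0 * (tail g ⊛ h) n) ≡⟨ regroup (f 0) (g 0) (h (suc n)) _ _ ⟩
  f 0 * (g 0 * h (suc n) + (tail g ⊛ h) n) + (tail f ⊛ (g ⊛ h)) n       ≡⟨ cong (λ t → f 0 * t + (tail f ⊛ (g ⊛ h)) n)
                                                                              (sym (⊛-at-suc g h n)) ⟩
  f 0 * (g ⊛ h) (suc n) + (tail f ⊛ (g ⊛ h)) n                        ≡⟨ sym (⊛-at-suc f (g ⊛ h) n) ⟩
  (f ⊛ (g ⊛ h)) (suc n)                                              ∎
  where
  open ≡-Reasoning
  regroup : ∀ a b c x y → a * b * c + (x + a * y) ≡ a * (b * c + y) + x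
  regroup = solve-∀

⊛-zeroˡ : ∀ f → 0ₛ ⊛ f ≗ 0ₛ
⊛-zeroˡ f n = trans (⊛-unfold 0ₛ f n) (sum<-zero (suc n) (λ _ _ → refl))

⊛-identityˡ : ∀ f → one ⊛ f ≗ f
⊛-identityˡ f zero    = trans (⊛-at-zero one f) (ℤP.*-identityˡ (f 0))
⊛-identityˡ f (suc n) = begin
  (one ⊛ f) (suc n)                    ≡⟨ ⊛-at-suc one f n ⟩
  + 1 * f (suc n) + (tail one ⊛ f) n   ≡⟨ cong₂ _+_ (ℤP.*-identityˡ (f (suc n))) (⊛-zeroˡ f n) ⟩
  f (suc n) + + 0                      ≡⟨ ℤP.+-identityʳ _ ⟩
  f (suc n)                            ∎
  where open ≡-Reasoning

⊛-identityʳ : ∀ f → f ⊛ one ≗ f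
⊛-identityʳ f n = trans (⊛-comm f one n) (⊛-identityˡ f n)

⊛-lcomm : ∀ f g h → f ⊛ (g ⊛ h) ≗ g ⊛ (f ⊛ h)
⊛-lcomm f g h n = trans (sym (⊛-assoc f g h n)) (trans (⊛-congˡ h (⊛-comm f g) n) (⊛-assoc g f h n))

pow-cong : ∀ {f g} k → f ≗ g → pow f k ≗ pow g k
pow-cong zero    e n = refl
pow-cong (suc k) e   = ⊛-cong e (pow-cong k e)

pow-at-zero : ∀ f k → f 0 ≡ + 1 → pow f k 0 ≡ + 1
pow-at-zero f zero    e = refl
pow-at-zero f (suc k) e = trans (⊛-at-zero f (pow f k)) (cong₂ _*_ e (pow-at-zero f k e))

pow-inverse : ∀ f g k → f ⊛ g ≗ one → pow f k ⊛ pow g k ≗ one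
pow-inverse f g zero    e n = ⊛-identityˡ one n
pow-inverse f g (suc k) e n = begin
  ((f ⊛ F) ⊛ (g ⊛ G)) n   ≡⟨ ⊛-assoc f F (g ⊛ G) n ⟩
  (f ⊛ (F ⊛ (g ⊛ G))) n   ≡⟨ ⊛-congʳ f (⊛-lcomm F g G) n ⟩
  (f ⊛ (g ⊛ (F ⊛ G))) n   ≡⟨ sym (⊛-assoc f g (F ⊛ G) n) ⟩
  ((f ⊛ g) ⊛ (F ⊛ G)) n   ≡⟨ ⊛-cong e (pow-inverse f g k e) n ⟩
  (one ⊛ one) n           ≡⟨ ⊛-identityˡ one n ⟩
  one n                   ∎
  where
  open ≡-Reasoning
  F = pow f k
  G = pow g k

⊛-inverse-unique : ∀ {f g h} → f ⊛ g ≗ one → g ⊛ h ≗ one → f ≗ h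
⊛-inverse-unique {f} {g} {h} fg≗1 gh≗1 n = begin
  f n                 ≡⟨ sym (⊛-identityʳ f n) ⟩
  (f ⊛ one) n         ≡⟨ ⊛-congʳ f (λ k → sym (gh≗1 k)) n ⟩
  (f ⊛ (g ⊛ h)) n     ≡⟨ sym (⊛-assoc f g h n) ⟩
  ((f ⊛ g) ⊛ h) n     ≡⟨ ⊛-congˡ h fg≗1 n ⟩
  (one ⊛ h) n         ≡⟨ ⊛-identityˡ h n ⟩
  h n                 ∎
  where open ≡-Reasoning

x^ : ℕ → Series
x^ q n = if n ≡ᵇ q then + 1 else + 0

x^-⊛-≥ : ∀ q f n → q ≤ n → (x^ q ⊛ f) n ≡ f (n ∸ q)
x^-⊛-≥ zero    f n       _         = ⊛-identityˡ f n
x^-⊛-≥ (suc q) f (suc n) (s≤s q≤n) = begin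
  (x^ (suc q) ⊛ f) (suc n)           ≡⟨ ⊛-at-suc (x^ (suc q)) f n ⟩
  + 0 * f (suc n) + (x^ q ⊛ f) n     ≡⟨ cong (_+_ (+ 0 * f (suc n))) (x^-⊛-≥ q f n q≤n) ⟩
  + 0 + f (n ∸ q)                    ≡⟨ ℤP.+-identityˡ _ ⟩
  f (n ∸ q)                          ∎
  where open ≡-Reasoning

x^-⊛-< : ∀ q f n → n < q → (x^ q ⊛ f) n ≡ + 0
x^-⊛-< (suc q) f zero    _         = ⊛-at-zero (x^ (suc q)) f
x^-⊛-< (suc q) f (suc n) (s≤s n<q) =
  trans (⊛-at-suc (x^ (suc q)) f n) (cong (_+_ (+ 0 * f (suc n))) (x^-⊛-< q f n n<q))

lin≗one-x^ : ∀ q .{{_ : ℕ.NonZero q}} → lin q ≗ one ⊕ -[1+ 0 ] · x^ q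
lin≗one-x^ (suc q) zero = refl
lin≗one-x^ (suc q) (suc n) with n ≡ᵇ q
... | true  = refl
... | false = refl

lin-⊛ : ∀ q .{{_ : ℕ.NonZero q}} f n → (lin q ⊛ f) n ≡ f n - (x^ q ⊛ f) n
lin-⊛ q f n = begin
  (lin q ⊛ f) n                                   ≡⟨ ⊛-congˡ f (lin≗one-x^ q) n ⟩
  ((one ⊕ -[1+ 0 ] · x^ q) ⊛ f) n                 ≡⟨ ⊛-distribʳ-⊕ f one (-[1+ 0 ] · x^ q) n ⟩
  (one ⊛ f) n + ((-[1+ 0 ] · x^ q) ⊛ f) n         ≡⟨ cong₂ _+_ (⊛-identityˡ f n)
                                                      (trans (⊛-·-assocˡ -[1+ 0 ] (x^ q) f n) (ℤP.-1*i≡-i _)) ⟩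
  f n - (x^ q ⊛ f) n                              ∎
  where open ≡-Reasoning

lin-⊛-≥ : ∀ q .{{_ : ℕ.NonZero q}} f n → q ≤ n → (lin q ⊛ f) n ≡ f n - f (n ∸ q)
lin-⊛-≥ q f n q≤n = trans (lin-⊛ q f n) (cong (λ t → f n - t) (x^-⊛-≥ q f n q≤n))

lin-⊛-< : ∀ q .{{_ : ℕ.NonZero q}} f n → n < q → (lin q ⊛ f) n ≡ f n
lin-⊛-< q f n n<q =
  trans (lin-⊛ q f n) (trans (cong (λ t → f n - t) (x^-⊛-< q f n n<q)) (ℤP.+-identityʳ (f n)))

geom-< : ∀ q .{{_ : ℕ.NonZero q}} n → n < q → geom q n ≡ one n
geom-< (suc q) zero    _ = refl
geom-< (suc q) (suc n) n<q with suc q ∣? suc n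
... | yes q∣n = ⊥-elim (ℕP.<⇒≱ n<q (ℕD.∣⇒≤ q∣n))
... | no  _   = refl

geom-periodic : ∀ q n → q ≤ n → geom q n ≡ geom q (n ∸ q)
geom-periodic q n q≤n with q ∣? n | q ∣? (n ∸ q)
... | yes _ | yes _ = refl
... | no  _ | no  _ = refl
... | yes q∣n | no q∤n-q = ⊥-elim (q∤n-q (ℕD.∣m+n∣m⇒∣n (subst (q ℕD.∣_) (sym (ℕP.m+[n∸m]≡n q≤n)) q∣n) ℕD.∣-refl))
... | no q∤n | yes q∣n-q = ⊥-elim (q∤n (ℕD.∣m∸n∣n⇒∣m q q≤n q∣n-q ℕD.∣-refl))

lin-⊛-geom : ∀ q .{{_ : ℕ.NonZero q}} → lin q ⊛ geom q ≗ one
lin-⊛-geom q@(suc _) n with q ≤? n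
... | no q≰n = trans (lin-⊛-< q (geom q) n (ℕP.≰⇒> q≰n)) (geom-< q n (ℕP.≰⇒> q≰n))
... | yes q≤n@(s≤s _) = begin
  (lin q ⊛ geom q) n                      ≡⟨ lin-⊛-≥ q (geom q) n q≤n ⟩
  geom q n - geom q (n ∸ q)               ≡⟨ cong (_- geom q (n ∸ q)) (geom-periodic q n q≤n) ⟩
  geom q (n ∸ q) - geom q (n ∸ q)         ≡⟨ ℤP.+-inverseʳ (geom q (n ∸ q)) ⟩
  one n                                   ∎
  where open ≡-Reasoning

geom-⊛-lin : ∀ q .{{_ : ℕ.NonZero q}} → geom q ⊛ lin q ≗ one
geom-⊛-lin q n = trans (⊛-comm (geom q) (lin q) n) (lin-⊛-geom q n)

one-at-nonzero : ∀ n .{{_ : ℕ.NonZero n}} → one n ≡ + 0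
one-at-nonzero (suc n) = refl

lin-at-< : ∀ q .{{_ : ℕ.NonZero q}} n .{{_ : ℕ.NonZero n}} → n < q → lin q n ≡ + 0
lin-at-< q n n<q = trans (sym (⊛-identityʳ (lin q) n)) (trans (lin-⊛-< q one n n<q) (one-at-nonzero n))

lin-at-self : ∀ q .{{_ : ℕ.NonZero q}} → lin q q ≡ -[1+ 0 ]
lin-at-self q = begin
  lin q q                     ≡⟨ sym (⊛-identityʳ (lin q) q) ⟩
  (lin q ⊛ one) q             ≡⟨ lin-⊛-≥ q one q ℕP.≤-refl ⟩
  one q - one (q ∸ q)         ≡⟨ cong₂ (λ a b → a - one b) (one-at-nonzero q) (ℕP.n∸n≡0 q) ⟩
  -[1+ 0 ]                    ∎
  where open ≡-Reasoning

lin-at-> : ∀ q .{{_ : ℕ.NonZero q}} n → q < n → lin q n ≡ + 0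
lin-at-> q n q<n = begin
  lin q n                     ≡⟨ sym (⊛-identityʳ (lin q) n) ⟩
  (lin q ⊛ one) n             ≡⟨ lin-⊛-≥ q one n (ℕP.<⇒≤ q<n) ⟩
  one n - one (n ∸ q)         ≡⟨ cong₂ _-_ (one-at-nonzero n {{ℕ.>-nonZero (ℕP.≤-<-trans z≤n q<n)}})
                                           (one-at-nonzero (n ∸ q) {{ℕ.>-nonZero (ℕP.m<n⇒0<n∸m q<n)}}) ⟩
  + 0                         ∎
  where open ≡-Reasoning

infix 4 _≡_mod_

record _≡_mod_ (a b M : ℤ) : Set where
  constructor by
  field
    quotient : ℤ
    quotient-spec : a ≡ b + quotient * M

module _ {M : ℤ} where

  ≡⇒≡mod : ∀ {a b} → a ≡ b → a ≡ b mod M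
  ≡⇒≡mod {b = b} a≡b = by (+ 0) (trans a≡b (sym (trans (cong (_+_ b) (ℤP.*-zeroˡ M)) (ℤP.+-identityʳ b))))

  ≡mod-sym : ∀ {a b} → a ≡ b mod M → b ≡ a mod M
  ≡mod-sym {b = b} (by t refl) = by (- t) (lemma b t M)
    where
    lemma : ∀ b t M → b ≡ b + t * M + - t * M
    lemma = solve-∀

  ≡mod-trans : ∀ {a b c} → a ≡ b mod M → b ≡ c mod M → a ≡ c mod M
  ≡mod-trans {c = c} (by t refl) (by s refl) = by (s + t) (lemma c s t M)
    where
    lemma : ∀ c s t M → c + s * M + t * M ≡ c + (s + t) * M
    lemma = solve-∀

  ≡mod-isEquivalence : IsEquivalence (_≡_mod M)
  ≡mod-isEquivalence = record { refl = ≡⇒≡mod refl ; sym = ≡mod-sym ; trans = ≡mod-trans }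

  ≡mod-setoid : Setoid 0ℓ 0ℓ
  ≡mod-setoid = record { isEquivalence = ≡mod-isEquivalence }

  ≡mod-refl : ∀ {a} → a ≡ a mod M
  ≡mod-refl = ≡⇒≡mod refl

  +-cong-≡mod : ∀ {a b c d} → a ≡ b mod M → c ≡ d mod M → a + c ≡ b + d mod M
  +-cong-≡mod {b = b} {d = d} (by t refl) (by s refl) = by (t + s) (lemma b d s t M)
    where
    lemma : ∀ b d s t M → b + t * M + (d + s * M) ≡ b + d + (t + s) * M
    lemma = solve-∀

  +-congˡ-≡mod : ∀ a {b c} → b ≡ c mod M → a + b ≡ a + c mod M
  +-congˡ-≡mod a = +-cong-≡mod (≡mod-refl {a})

  *-cong-≡mod : ∀ {a b c d} → a ≡ b mod M → c ≡ d mod M → a * c ≡ b * d mod M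
  *-cong-≡mod {b = b} {d = d} (by t refl) (by s refl) = by (t * d + b * s + t * s * M) (lemma b d s t M)
    where
    lemma : ∀ b d s t M → (b + t * M) * (d + s * M) ≡ b * d + (t * d + b * s + t * s * M) * M
    lemma = solve-∀

  neg-cong-≡mod : ∀ {a b} → a ≡ b mod M → - a ≡ - b mod M
  neg-cong-≡mod {b = b} (by t refl) = by (- t) (lemma b t M)
    where
    lemma : ∀ b t M → - (b + t * M) ≡ - b + - t * M
    lemma = solve-∀

  *-multiple-≡mod : ∀ x → M * x ≡ + 0 mod M
  *-multiple-≡mod x = by x (trans (ℤP.*-comm M x) (sym (ℤP.+-identityˡ (x * M))))

  *-scale-≡mod : ∀ {a b} c → a ≡ b mod M → c * a ≡ c * b mod c * M
  *-scale-≡mod {b = b} c (by t refl) = by t (lemma b c t M)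
    where
    lemma : ∀ b c t M → c * (b + t * M) ≡ c * b + t * (c * M)
    lemma = solve-∀

  ≡mod-weaken : ∀ {N a b} → a ≡ b mod M * N → a ≡ b mod M
  ≡mod-weaken {N} {b = b} (by t refl) = by (t * N) (lemma b t M N)
    where
    lemma : ∀ b t M N → b + t * (M * N) ≡ b + t * N * M
    lemma = solve-∀

module ≡mod-Reasoning (M : ℤ) where
  open import Relation.Binary.Reasoning.Setoid (≡mod-setoid {M}) public

sum<-cong-≡mod : ∀ {M} {h h' : ℕ → ℤ} m → (∀ k → k < m → h k ≡ h' k mod M) → sum< h m ≡ sum< h' m mod M
sum<-cong-≡mod zero    h≡h' = ≡mod-refl
sum<-cong-≡mod (suc m) h≡h' = +-cong-≡mod (h≡h' 0 (s≤s z≤n)) (sum<-cong-≡mod m (λ k k<m → h≡h' (suc k) (s≤s k<m)))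

⊛-cong-≡mod : ∀ {M} f f' g g' n → (∀ k → k ≤ n → f k ≡ f' k mod M) → (∀ k → k ≤ n → g k ≡ g' k mod M) →
              (f ⊛ g) n ≡ (f' ⊛ g') n mod M
⊛-cong-≡mod f f' g g' n f≡f' g≡g' =
  subst₂ (_≡_mod _) (sym (⊛-unfold f g n)) (sym (⊛-unfold f' g' n))
    (sum<-cong-≡mod (suc n) λ k k≤n → *-cong-≡mod (f≡f' k (ℕP.≤-pred k≤n)) (g≡g' (n ∸ k) (ℕP.m∸n≤m n k)))

module Stretch (p : ℕ) {{p≢0 : ℕ.NonZero p}} where

  stretch : Series → Series
  stretch f n = if n % p ≡ᵇ 0 then f (n / p) else + 0

  stretch-at-multiple : ∀ f m → stretch f (m ℕ.* p) ≡ f m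
  stretch-at-multiple f m rewrite m*n%n≡0 m p {{p≢0}} | m*n/n≡m m p {{p≢0}} = refl

  stretch-off : ∀ f m r → 0 < r → r < p → stretch f (r ℕ.+ m ℕ.* p) ≡ + 0
  stretch-off f m r@(suc _) _ r<p rewrite [m+kn]%n≡m%n r m p {{p≢0}} | m<n⇒m%n≡m {{p≢0}} r<p = refl

  stretch-below : ∀ f r → 0 < r → r < p → stretch f r ≡ + 0
  stretch-below f r@(suc _) _ r<p rewrite m<n⇒m%n≡m {{p≢0}} r<p = refl

  stretch-below-* : ∀ f k x → 0 < k → k < p → stretch f k * x ≡ + 0
  stretch-below-* f k x 0<k k<p = trans (cong (_* x) (stretch-below f k 0<k k<p)) (ℤP.*-zeroˡ x)

  stretch-unique : ∀ f g → (∀ m → g (m ℕ.* p) ≡ f m) →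
                   (∀ m r → 0 < r → r < p → g (r ℕ.+ m ℕ.* p) ≡ + 0) → stretch f ≗ g
  stretch-unique f g at-multiple off n with n % p in n%p | m≡m%n+[m/n]*n n p
  ... | zero  | n≡ = sym (trans (cong g n≡) (at-multiple (n / p)))
  ... | suc r | n≡ = sym (trans (cong g n≡) (off (n / p) (suc r) (s≤s z≤n) (subst (_< p) n%p (m%n<n n p))))

  stretch-cong-at : ∀ f g n → f (n / p) ≡ g (n / p) → stretch f n ≡ stretch g n
  stretch-cong-at f g n f≡g = cong (λ t → if n % p ≡ᵇ 0 then t else + 0) f≡g

  stretch-cong-≡mod : ∀ {M} f g k → f (k / p) ≡ g (k / p) mod M → stretch f k ≡ stretch g k mod M
  stretch-cong-≡mod f g k f≡g with k % p ≡ᵇ 0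
  ... | true  = f≡g
  ... | false = ≡mod-refl

  stretch-cong : ∀ {f g} → f ≗ g → stretch f ≗ stretch g
  stretch-cong {f} {g} f≗g n = stretch-cong-at f g n (f≗g (n / p))

  stretch-⊕ : ∀ f g → stretch (f ⊕ g) ≗ stretch f ⊕ stretch g
  stretch-⊕ f g n with n % p ≡ᵇ 0
  ... | true  = refl
  ... | false = refl

  stretch-· : ∀ c f → stretch (c · f) ≗ c · stretch f
  stretch-· c f n with n % p ≡ᵇ 0
  ... | true  = refl
  ... | false = sym (ℤP.*-zeroʳ c)

  drop : ℕ → Series → Series
  drop j f n = f (j ℕ.+ n)

  stretch-tail : ∀ f → stretch (tail f) ≗ drop p (stretch f)
  stretch-tail f = stretch-unique (tail f) (drop p (stretch f)) (λ m → stretch-at-multiple f (suc m))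
    (λ m r 0<r r<p → trans (cong (stretch f) (+-shuffle p r m)) (stretch-off f (suc m) r 0<r r<p))
    where
    +-shuffle : ∀ q r m → q ℕ.+ (r ℕ.+ m ℕ.* q) ≡ r ℕ.+ (q ℕ.+ m ℕ.* q)
    +-shuffle = ℕ-Solver.solve-∀

  ⊛-at-+ : ∀ j u v n → (u ⊛ v) (j ℕ.+ n) ≡ sum< (λ k → u k * v (j ℕ.+ n ∸ k)) j + (drop j u ⊛ v) n
  ⊛-at-+ zero    u v n = sym (ℤP.+-identityˡ _)
  ⊛-at-+ (suc j) u v n = begin
    (u ⊛ v) (suc j ℕ.+ n)                                                  ≡⟨ ⊛-at-suc u v (j ℕ.+ n) ⟩
    u 0 * v (suc j ℕ.+ n) + (tail u ⊛ v) (j ℕ.+ n)                          ≡⟨ cong (_+_ (u 0 * v (suc j ℕ.+ n))) (⊛-at-+ j (tail u) v n) ⟩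
    u 0 * v (suc j ℕ.+ n) + (sum< (λ k → u (suc k) * v (j ℕ.+ n ∸ k)) j + (drop (suc j) u ⊛ v) n)
                                                                            ≡⟨ sym (ℤP.+-assoc (u 0 * v (suc j ℕ.+ n)) _ _) ⟩
    sum< (λ k → u k * v (suc j ℕ.+ n ∸ k)) (suc j) + (drop (suc j) u ⊛ v) n ∎
    where open ≡-Reasoning

  stretch-⊛-stretch-below : ∀ f g r → r < p → (stretch f ⊛ stretch g) r ≡ f 0 * stretch g r
  stretch-⊛-stretch-below f g r r<p = begin
    (stretch f ⊛ stretch g) r                            ≡⟨ ⊛-unfold (stretch f) (stretch g) r ⟩
    sum< (λ k → stretch f k * stretch g (r ∸ k)) (suc r)  ≡⟨ sum<-head (suc r) (s≤s z≤n) (λ k 0<k k≤r →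
                                                               stretch-below-* f k (stretch g (r ∸ k)) 0<k (ℕP.<-≤-trans k≤r r<p)) ⟩
    stretch f 0 * stretch g r                            ≡⟨ cong (_* stretch g r) (stretch-at-multiple f 0) ⟩
    f 0 * stretch g r                                    ∎
    where open ≡-Reasoning

  stretch-⊛-stretch-above : ∀ f g n →
    (stretch f ⊛ stretch g) (p ℕ.+ n) ≡ f 0 * stretch g (p ℕ.+ n) + (stretch (tail f) ⊛ stretch g) n
  stretch-⊛-stretch-above f g n = begin
    (stretch f ⊛ stretch g) (p ℕ.+ n)                                     ≡⟨ ⊛-at-+ p (stretch f) (stretch g) n ⟩
    sum< (λ k → stretch f k * stretch g (p ℕ.+ n ∸ k)) p + (drop p (stretch f) ⊛ stretch g) n
                                                                           ≡⟨ cong₂ _+_ (sum<-head p (ℕ.>-nonZero⁻¹ p) λ k →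
                                                                                          stretch-below-* f k (stretch g (p ℕ.+ n ∸ k)))
                                                                                (sym (⊛-congˡ (stretch g) (stretch-tail f) n)) ⟩
    stretch f 0 * stretch g (p ℕ.+ n) + (stretch (tail f) ⊛ stretch g) n   ≡⟨ cong (λ t → t * stretch g (p ℕ.+ n) + (stretch (tail f) ⊛ stretch g) n)
                                                                                   (stretch-at-multiple f 0) ⟩
    f 0 * stretch g (p ℕ.+ n) + (stretch (tail f) ⊛ stretch g) n           ∎
    where open ≡-Reasoning

  stretch-⊛-below : ∀ f g r → r < p → stretch (f ⊛ g) r ≡ f 0 * stretch g r
  stretch-⊛-below f g zero    _   = trans (stretch-at-multiple (f ⊛ g) 0)
                                      (trans (⊛-at-zero f g) (cong (f 0 *_) (sym (stretch-at-multiple g 0))))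
  stretch-⊛-below f g r@(suc _) r<p = trans (stretch-below (f ⊛ g) r (s≤s z≤n) r<p)
                                      (sym (trans (cong (f 0 *_) (stretch-below g r (s≤s z≤n) r<p)) (ℤP.*-zeroʳ (f 0))))

  stretch-⊛-above : ∀ f g n → stretch (f ⊛ g) (p ℕ.+ n) ≡ f 0 * stretch g (p ℕ.+ n) + stretch (tail f ⊛ g) n
  stretch-⊛-above f g n = begin
    stretch (f ⊛ g) (p ℕ.+ n)                                   ≡⟨ sym (stretch-tail (f ⊛ g) n) ⟩
    stretch (tail (f ⊛ g)) n                                    ≡⟨ stretch-cong (tail-⊛ f g) n ⟩
    stretch (tail f ⊛ g ⊕ f 0 · tail g) n                       ≡⟨ stretch-⊕ (tail f ⊛ g) (f 0 · tail g) n ⟩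
    stretch (tail f ⊛ g) n + stretch (f 0 · tail g) n            ≡⟨ cong (_+_ (stretch (tail f ⊛ g) n))
                                                                      (trans (stretch-· (f 0) (tail g) n) (cong (f 0 *_) (stretch-tail g n))) ⟩
    stretch (tail f ⊛ g) n + f 0 * stretch g (p ℕ.+ n)           ≡⟨ ℤP.+-comm (stretch (tail f ⊛ g) n) _ ⟩
    f 0 * stretch g (p ℕ.+ n) + stretch (tail f ⊛ g) n           ∎
    where open ≡-Reasoning

  stretch-⊛ : ∀ f g → stretch (f ⊛ g) ≗ stretch f ⊛ stretch g
  stretch-⊛ f g n = begin
    stretch (f ⊛ g) n                              ≡⟨ cong (stretch (f ⊛ g)) n≡ ⟩
    stretch (f ⊛ g) ((n / p) ℕ.* p ℕ.+ n % p)      ≡⟨ agree (n / p) f (m%n<n n p) ⟩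
    (stretch f ⊛ stretch g) ((n / p) ℕ.* p ℕ.+ n % p) ≡⟨ cong (stretch f ⊛ stretch g) (sym n≡) ⟩
    (stretch f ⊛ stretch g) n                      ∎
    where
    open ≡-Reasoning
    n≡ : n ≡ (n / p) ℕ.* p ℕ.+ n % p
    n≡ = trans (m≡m%n+[m/n]*n n p) (ℕP.+-comm (n % p) _)
    agree : ∀ m f {r} → r < p → stretch (f ⊛ g) (m ℕ.* p ℕ.+ r) ≡ (stretch f ⊛ stretch g) (m ℕ.* p ℕ.+ r)
    agree zero    f {r} r<p = trans (stretch-⊛-below f g r r<p) (sym (stretch-⊛-stretch-below f g r r<p))
    agree (suc m) f {r} r<p = begin
      stretch (f ⊛ g) (p ℕ.+ m ℕ.* p ℕ.+ r)                                   ≡⟨ cong (stretch (f ⊛ g)) (ℕP.+-assoc p _ r) ⟩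
      stretch (f ⊛ g) (p ℕ.+ (m ℕ.* p ℕ.+ r))                                 ≡⟨ stretch-⊛-above f g _ ⟩
      f 0 * stretch g (p ℕ.+ (m ℕ.* p ℕ.+ r)) + stretch (tail f ⊛ g) (m ℕ.* p ℕ.+ r)
                                                                               ≡⟨ cong (_+_ (f 0 * stretch g (p ℕ.+ (m ℕ.* p ℕ.+ r))))
                                                                                       (agree m (tail f) r<p) ⟩
      f 0 * stretch g (p ℕ.+ (m ℕ.* p ℕ.+ r)) + (stretch (tail f) ⊛ stretch g) (m ℕ.* p ℕ.+ r)
                                                                               ≡⟨ sym (stretch-⊛-stretch-above f g _) ⟩
      (stretch f ⊛ stretch g) (p ℕ.+ (m ℕ.* p ℕ.+ r))                         ≡⟨ cong (stretch f ⊛ stretch g) (sym (ℕP.+-assoc p _ r)) ⟩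
      (stretch f ⊛ stretch g) (p ℕ.+ m ℕ.* p ℕ.+ r)                           ∎

  stretch-one : stretch one ≗ one
  stretch-one = stretch-unique one one (one-at-multiple p) one-off
    where
    one-at-multiple : ∀ q .{{_ : ℕ.NonZero q}} m → one (m ℕ.* q) ≡ one m
    one-at-multiple (suc _) zero    = refl
    one-at-multiple (suc _) (suc m) = refl
    one-off : ∀ m r → 0 < r → r < p → one (r ℕ.+ m ℕ.* p) ≡ + 0
    one-off m (suc r) _ _ = refl

  stretch-pow : ∀ f k → stretch (pow f k) ≗ pow (stretch f) k
  stretch-pow f zero    = stretch-one
  stretch-pow f (suc k) n = trans (stretch-⊛ f (pow f k) n) (⊛-congʳ (stretch f) (stretch-pow f k) n)

  ∤-off : ∀ m r → 0 < r → r < p → ¬ (p ∣ r ℕ.+ m ℕ.* p)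
  ∤-off m r@(suc _) _ r<p p∣ =
    ℕP.<⇒≱ r<p (ℕD.∣⇒≤ (ℕD.∣m+n∣m⇒∣n (subst (p ∣_) (ℕP.+-comm r (m ℕ.* p)) p∣) (ℕD.n∣m*n m)))

  stretch-geom : ∀ q → stretch (geom q) ≗ geom (p ℕ.* q)
  stretch-geom q = stretch-unique (geom q) (geom (p ℕ.* q)) at-multiple off
    where
    at-multiple : ∀ m → geom (p ℕ.* q) (m ℕ.* p) ≡ geom q m
    at-multiple m with p ℕ.* q ∣? m ℕ.* p | q ∣? m
    ... | yes _ | yes _ = refl
    ... | no  _ | no  _ = refl
    ... | yes pq∣mp | no q∤m = ⊥-elim (q∤m (ℕD.*-cancelʳ-∣ p (subst (_∣ m ℕ.* p) (ℕP.*-comm p q) pq∣mp)))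
    ... | no pq∤mp | yes q∣m = ⊥-elim (pq∤mp (subst (_∣ m ℕ.* p) (ℕP.*-comm q p) (ℕD.*-monoˡ-∣ p q∣m)))
    off : ∀ m r → 0 < r → r < p → geom (p ℕ.* q) (r ℕ.+ m ℕ.* p) ≡ + 0
    off m r 0<r r<p with p ℕ.* q ∣? r ℕ.+ m ℕ.* p
    ... | yes pq∣ = ⊥-elim (∤-off m r 0<r r<p (ℕD.∣-trans (ℕD.m∣m*n q) pq∣))
    ... | no  _   = refl

  stretch-lin : ∀ q .{{_ : ℕ.NonZero q}} → stretch (lin q) ≗ lin (p ℕ.* q)
  stretch-lin q = ⊛-inverse-unique stretch-lin⊛geom (geom-⊛-lin (p ℕ.* q) {{ℕP.m*n≢0 p q}})
    where
    stretch-lin⊛geom : stretch (lin q) ⊛ geom (p ℕ.* q) ≗ one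
    stretch-lin⊛geom n = begin
      (stretch (lin q) ⊛ geom (p ℕ.* q)) n         ≡⟨ ⊛-congʳ (stretch (lin q)) (λ k → sym (stretch-geom q k)) n ⟩
      (stretch (lin q) ⊛ stretch (geom q)) n       ≡⟨ sym (stretch-⊛ (lin q) (geom q) n) ⟩
      stretch (lin q ⊛ geom q) n                   ≡⟨ stretch-cong (lin-⊛-geom q) n ⟩
      stretch one n                                ≡⟨ stretch-one n ⟩
      one n                                        ∎
      where open ≡-Reasoning

θ : Series → Series
θ f n = + n * f n

θ-⊛ : ∀ f g → θ (f ⊛ g) ≗ θ f ⊛ g ⊕ f ⊛ θ g
θ-⊛ f g n = begin
  + n * (f ⊛ g) n                                                        ≡⟨ cong (+ n *_) (⊛-unfold f g n) ⟩
  + n * sum< (λ k → f k * g (n ∸ k)) (suc n)                              ≡⟨ sym (sum<-*ˡ (+ n) (λ k → f k * g (n ∸ k)) (suc n)) ⟩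
  sum< (λ k → + n * (f k * g (n ∸ k))) (suc n)                            ≡⟨ sum<-cong (suc n) (λ k k≤n → leibniz k (ℕP.≤-pred k≤n)) ⟩
  sum< (λ k → θ f k * g (n ∸ k) + f k * θ g (n ∸ k)) (suc n)
                                                                          ≡⟨ sum<-+ (λ k → θ f k * g (n ∸ k)) (λ k → f k * θ g (n ∸ k)) (suc n) ⟩
  sum< (λ k → θ f k * g (n ∸ k)) (suc n) + sum< (λ k → f k * θ g (n ∸ k)) (suc n)
                                                                          ≡⟨ sym (cong₂ _+_ (⊛-unfold (θ f) g n) (⊛-unfold f (θ g) n)) ⟩
  (θ f ⊛ g ⊕ f ⊛ θ g) n                                                  ∎
  where
  open ≡-Reasoning
  distrib : ∀ a b x y → (a + b) * (x * y) ≡ a * x * y + x * (b * y)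
  distrib = solve-∀
  leibniz : ∀ k → k ≤ n → + n * (f k * g (n ∸ k)) ≡ θ f k * g (n ∸ k) + f k * θ g (n ∸ k)
  leibniz k k≤n = trans (cong (λ m → + m * (f k * g (n ∸ k))) (sym (ℕP.m+[n∸m]≡n k≤n)))
                        (distrib (+ k) (+ (n ∸ k)) (f k) (g (n ∸ k)))

θ-one : θ one ≗ 0ₛ
θ-one zero    = refl
θ-one (suc n) = ℤP.*-zeroʳ (+ suc n)

θ-pow : ∀ f k → θ (pow f (suc k)) ≗ + suc k · (pow f k ⊛ θ f)
θ-pow f zero    n = begin
  θ (f ⊛ one) n                 ≡⟨ θ-⊛ f one n ⟩
  (θ f ⊛ one) n + (f ⊛ θ one) n  ≡⟨ cong₂ _+_ (⊛-identityʳ (θ f) n)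
                                     (trans (⊛-congʳ f θ-one n) (trans (⊛-comm f 0ₛ n) (⊛-zeroˡ f n))) ⟩
  θ f n + + 0                   ≡⟨ ℤP.+-identityʳ (θ f n) ⟩
  θ f n                         ≡⟨ sym (trans (ℤP.*-identityˡ _) (⊛-identityˡ (θ f) n)) ⟩
  + 1 * (one ⊛ θ f) n           ∎
  where open ≡-Reasoning
θ-pow f (suc k) n = begin
  θ (f ⊛ F) n                             ≡⟨ θ-⊛ f F n ⟩
  (θ f ⊛ F) n + (f ⊛ θ F) n                ≡⟨ cong₂ _+_ (⊛-comm (θ f) F n)
                                               (trans (⊛-congʳ f (θ-pow f k) n)
                                                 (trans (⊛-·-assocʳ (+ suc k) f (pow f k ⊛ θ f) n)
                                                        (cong (+ suc k *_) (sym (⊛-assoc f (pow f k) (θ f) n))))) ⟩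
  (F ⊛ θ f) n + + suc k * (F ⊛ θ f) n      ≡⟨ collect ((F ⊛ θ f) n) (+ suc k) ⟩
  (+ 1 + + suc k) * (F ⊛ θ f) n            ∎
  where
  open ≡-Reasoning
  F = pow f (suc k)
  collect : ∀ a c → a + c * a ≡ (+ 1 + c) * a
  collect = solve-∀

pow-lin1-at-zero : ∀ k → pow (lin 1) k 0 ≡ + 1
pow-lin1-at-zero zero    = refl
pow-lin1-at-zero (suc k) = trans (lin-⊛-< 1 (pow (lin 1) k) 0 (s≤s z≤n)) (pow-lin1-at-zero k)

pow-lin1-above : ∀ k n → k < n → pow (lin 1) k n ≡ + 0
pow-lin1-above zero    (suc n) _         = refl
pow-lin1-above (suc k) (suc n) (s≤s k<n) = begin
  (lin 1 ⊛ pow (lin 1) k) (suc n)              ≡⟨ lin-⊛-≥ 1 (pow (lin 1) k) (suc n) (s≤s z≤n) ⟩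
  pow (lin 1) k (suc n) - pow (lin 1) k n      ≡⟨ cong₂ _-_ (pow-lin1-above k (suc n) (ℕP.m<n⇒m<1+n k<n)) (pow-lin1-above k n k<n) ⟩
  + 0                                          ∎
  where open ≡-Reasoning

pow-lin1-top : ∀ k → pow (lin 1) k k ≡ -1ℤ ℤ.^ k
pow-lin1-top zero    = refl
pow-lin1-top (suc k) = begin
  (lin 1 ⊛ pow (lin 1) k) (suc k)              ≡⟨ lin-⊛-≥ 1 (pow (lin 1) k) (suc k) (s≤s z≤n) ⟩
  pow (lin 1) k (suc k) - pow (lin 1) k k      ≡⟨ cong₂ _-_ (pow-lin1-above k (suc k) (ℕP.n<1+n k)) (pow-lin1-top k) ⟩
  + 0 - -1ℤ ℤ.^ k                                ≡⟨ ℤP.+-identityˡ (- (-1ℤ ℤ.^ k)) ⟩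
  - (-1ℤ ℤ.^ k)                                  ≡⟨ sym (ℤP.-1*i≡-i (-1ℤ ℤ.^ k)) ⟩
  -1ℤ ℤ.^ suc k                                  ∎
  where open ≡-Reasoning

θ-pow-lin1-≡mod : ∀ k n → + n * pow (lin 1) k n ≡ + 0 mod + k
θ-pow-lin1-≡mod zero    zero    = ≡mod-refl
θ-pow-lin1-≡mod zero    (suc n) = ≡⇒≡mod (ℤP.*-zeroʳ (+ suc n))
θ-pow-lin1-≡mod (suc k) n = by ((pow (lin 1) k ⊛ θ (lin 1)) n) (trans (θ-pow (lin 1) k n) (+-zero-comm (+ suc k) _))
  where
  +-zero-comm : ∀ a x → a * x ≡ + 0 + x * a
  +-zero-comm = solve-∀

prime-cancel-≡mod : ∀ {p} → Prime p → ∀ n x → 0 < n → n < p → + n * x ≡ + 0 mod + p → x ≡ + 0 mod + p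
prime-cancel-≡mod {p} p-prime n x 0<n n<p (by t nx≡tp) with euclidsLemma n ∣ x ∣ p-prime p∣n∣x∣
  where
  p∣n∣x∣ : p ∣ n ℕ.* ∣ x ∣
  p∣n∣x∣ = divides ∣ t ∣ (trans (sym (ℤP.abs-* (+ n) x))
                          (trans (cong ∣_∣ (trans nx≡tp (ℤP.+-identityˡ (t * + p)))) (ℤP.abs-* t (+ p))))
... | inj₁ p∣n = ⊥-elim (ℕP.<⇒≱ n<p (ℕD.∣⇒≤ {{ℕ.>-nonZero 0<n}} p∣n))
... | inj₂ (divides s ∣x∣≡sp) with ℤP.+∣i∣≡i⊎+∣i∣≡-i x
...   | inj₁ ∣x∣≡x  = by (+ s) (trans (sym ∣x∣≡x) (trans (cong +_ ∣x∣≡sp) (trans (ℤP.pos-* s p) (sym (ℤP.+-identityˡ _)))))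
...   | inj₂ ∣x∣≡-x = by (- + s) (trans (sym (ℤP.neg-involutive x)) (trans (cong -_ (sym ∣x∣≡-x))
                        (trans (cong (λ m → - (+ m)) ∣x∣≡sp) (trans (cong -_ (ℤP.pos-* s p)) (neg-as-sum (+ s) (+ p))))))
  where
  neg-as-sum : ∀ a b → - (a * b) ≡ + 0 + - a * b
  neg-as-sum = solve-∀

-1^-even : ∀ m → -1ℤ ℤ.^ (m ℕ.* 2) ≡ 1ℤ
-1^-even zero    = refl
-1^-even (suc m) rewrite -1^-even m = refl

-1^-odd-prime : ∀ {p} → Prime p → 3 ≤ p → -1ℤ ℤ.^ p ≡ -1ℤ
-1^-odd-prime {p} p-prime 3≤p with p % 2 in p%2≡ | m≡m%n+[m/n]*n p 2
... | 0 | _ = ⊥-elim (Prime.notComposite p-prime (hasNonTrivialDivisor {divisor = 2} 3≤p (ℕD.m%n≡0⇒n∣m p 2 p%2≡)))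
... | 1 | p≡ rewrite p≡ | -1^-even (p / 2) = refl
... | suc (suc _) | _ = ⊥-elim (ℕP.<⇒≱ (subst (_< 2) p%2≡ (m%n<n p 2)) (s≤s (s≤s z≤n)))

record PowLinRemainder (p : ℕ) : Set where
  field
    R : Series
    pow-lin1≡lin+pR : ∀ n → pow (lin 1) p n ≡ lin p n + R n * + p
    R-at-zero : R 0 ≡ + 0
    R-above : ∀ n → p ≤ n → R n ≡ + 0

powLinRemainder : ∀ {p} → Prime p → 3 ≤ p → PowLinRemainder p
powLinRemainder {p@(suc _)} p-prime 3≤p = record
  { R               = λ n → _≡_mod_.quotient (proj₁ (remainder n))
  ; pow-lin1≡lin+pR = λ n → _≡_mod_.quotient-spec (proj₁ (remainder n))
  ; R-at-zero       = proj₂ (remainder 0) (inj₁ refl)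
  ; R-above         = λ n p≤n → proj₂ (remainder n) (inj₂ p≤n)
  }
  where
  remainder : ∀ n → Σ (pow (lin 1) p n ≡ lin p n mod + p) λ c≡ → n ≡ 0 ⊎ p ≤ n → _≡_mod_.quotient c≡ ≡ + 0
  remainder zero = ≡⇒≡mod (pow-lin1-at-zero p) , λ _ → refl
  remainder n@(suc _) with ℕP.<-cmp n p
  ... | tri< n<p _ _ = subst (λ l → pow (lin 1) p n ≡ l mod + p) (sym (lin-at-< p n n<p))
                         (prime-cancel-≡mod p-prime n _ (s≤s z≤n) n<p (θ-pow-lin1-≡mod p n))
                     , λ { (inj₂ p≤n) → ⊥-elim (ℕP.<⇒≱ n<p p≤n) }
  ... | tri≈ _ refl _ = ≡⇒≡mod (trans (pow-lin1-top p) (trans (-1^-odd-prime p-prime 3≤p) (sym (lin-at-self p)))) , λ _ → refl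
  ... | tri> _ _ p<n  = ≡⇒≡mod (trans (pow-lin1-above p n p<n) (sym (lin-at-> p n p<n))) , λ _ → refl

quotient-≤ : ∀ d {r r' q q'} → r' < d → + r + q * + d ≡ + r' + q' * + d → q ℤ.≤ q'
quotient-≤ d {r} {r'} {q} {q'} r'<d eq = ℤP.≮⇒≥ λ q'<q → ℤP.<-irrefl (sym eq) (right<left q'<q)
  where
  open ℤP.≤-Reasoning
  suc-* : ∀ q d → (+ 1 + q) * d ≡ d + q * d
  suc-* = solve-∀
  right<left : q' ℤ.< q → + r' + q' * + d ℤ.< + r + q * + d
  right<left q'<q = begin-strict
    + r' + q' * + d       <⟨ ℤP.+-monoˡ-< (q' * + d) (+<+ r'<d) ⟩
    + d + q' * + d        ≡⟨ sym (suc-* q' (+ d)) ⟩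
    ℤ.suc q' * + d        ≤⟨ ℤP.*-monoʳ-≤-nonNeg (+ d) (ℤP.i<j⇒suc[i]≤j q'<q) ⟩
    q * + d               ≤⟨ ℤP.i≤j+i (q * + d) (+ r) ⟩
    + r + q * + d         ∎

division-unique : ∀ d {r r' q q'} → r < d → r' < d → + r + q * + d ≡ + r' + q' * + d → r ≡ r' × q ≡ q'
division-unique d {r} {r'} {q} {q'} r<d r'<d eq = ℤP.+-injective r≡r' , q≡q'
  where
  q≡q' : q ≡ q'
  q≡q' = ℤP.≤-antisym (quotient-≤ d r'<d eq) (quotient-≤ d r<d (sym eq))
  cancel : ∀ x y → x + y + - y ≡ x
  cancel = solve-∀
  r≡r' : + r ≡ + r'
  r≡r' = begin
    + r                           ≡⟨ sym (cancel (+ r) (q' * + d)) ⟩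
    + r + q' * + d + - (q' * + d) ≡⟨ cong (λ t → + r + t * + d + - (q' * + d)) (sym q≡q') ⟩
    + r + q * + d + - (q' * + d)  ≡⟨ cong (_+ - (q' * + d)) eq ⟩
    + r' + q' * + d + - (q' * + d) ≡⟨ cancel (+ r') (q' * + d) ⟩
    + r'                          ∎
    where open ≡-Reasoning

module _ (d : ℕ) .{{_ : ℕ.NonZero d}} (a k : ℤ) where

  private
    decomposition : a + k * + d ≡ + (a %ℕ d) + (a /ℕ d + k) * + d
    decomposition = trans (cong (_+ k * + d) (a≡a%ℕn+[a/ℕn]*n a d)) (regroup (+ (a %ℕ d)) (a /ℕ d) k (+ d))
      where
      regroup : ∀ r q k d → r + q * d + k * d ≡ r + (q + k) * d
      regroup = solve-∀
    unique : (a + k * + d) %ℕ d ≡ a %ℕ d × (a + k * + d) /ℕ d ≡ a /ℕ d + k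
    unique = division-unique d {q = (a + k * + d) /ℕ d} {q' = a /ℕ d + k} (n%ℕd<d (a + k * + d) d) (n%ℕd<d a d)
               (trans (sym (a≡a%ℕn+[a/ℕn]*n (a + k * + d) d)) decomposition)

  [a+kd]%ℕd≡a%ℕd : (a + k * + d) %ℕ d ≡ a %ℕ d
  [a+kd]%ℕd≡a%ℕd = proj₁ unique

  [a+kd]/ℕd≡a/ℕd+k : (a + k * + d) /ℕ d ≡ a /ℕ d + k
  [a+kd]/ℕd≡a/ℕd+k = proj₂ unique

resDiv-cong : ∀ p {a b} → a ≡ b mod + p * + p → resDiv p a ≡ resDiv p b
resDiv-cong zero          _               = refl
resDiv-cong p@(suc _) {b = b} (by t refl) = begin
  ((b + t * (+ p * + p)) /ℕ p) %ℕ p    ≡⟨ cong (λ c → ((b + c) /ℕ p) %ℕ p) (sym (ℤP.*-assoc t (+ p) (+ p))) ⟩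
  ((b + t * + p * + p) /ℕ p) %ℕ p      ≡⟨ cong (_%ℕ p) ([a+kd]/ℕd≡a/ℕd+k p b (t * + p)) ⟩
  (b /ℕ p + t * + p) %ℕ p              ≡⟨ [a+kd]%ℕd≡a%ℕd p (b /ℕ p) t ⟩
  (b /ℕ p) %ℕ p                        ∎
  where open ≡-Reasoning

n<p^n : ∀ {p} → 2 ≤ p → ∀ n → n < p ^ n
n<p^n 2≤p zero    = s≤s z≤n
n<p^n {p} 2≤p (suc n) = begin-strict
  suc n              ≤⟨ n<p^n 2≤p n ⟩
  p ^ n              <⟨ ℕP.m<m*n (p ^ n) p {{ℕP.m^n≢0 p n {{ℕ.>-nonZero (ℕP.<-trans (s≤s z≤n) 2≤p)}}}} 2≤p ⟩
  p ^ n ℕ.* p        ≡⟨ ℕP.*-comm (p ^ n) p ⟩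
  p ^ suc n          ∎
  where open ℕP.≤-Reasoning

module StretchRecursion (p : ℕ) {{p≢0 : ℕ.NonZero p}} (2≤p : 2 ≤ p)
  (X : ℕ → Series) (B E : Series)
  (X-suc : ∀ N → X (suc N) ≗ B ⊛ Stretch.stretch p (X N))
  (X-zero-at-zero : X 0 0 ≡ + 1)
  (B-at-zero : B 0 ≡ + 1)
  (B≡1+pE : ∀ n → B n ≡ one n + + p * E n mod + p * + p)
  (E-periodic : ∀ n → E (n ℕ.+ p) ≡ E n mod + p)
  (E-at-zero : E 0 ≡ + 0 mod + p)
  where

  open Stretch p

  P : ℤ
  P = + p

  X-at-zero : ∀ N → X N 0 ≡ + 1
  X-at-zero zero    = X-zero-at-zero
  X-at-zero (suc N) = begin
    X (suc N) 0                    ≡⟨ X-suc N 0 ⟩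
    (B ⊛ stretch (X N)) 0          ≡⟨ ⊛-at-zero B (stretch (X N)) ⟩
    B 0 * stretch (X N) 0          ≡⟨ cong₂ _*_ B-at-zero (trans (stretch-at-multiple (X N) 0) (X-at-zero N)) ⟩
    + 1                            ∎
    where open ≡-Reasoning

  /p<p^ : ∀ N {k} → k < p ^ suc N → k / p < p ^ N
  /p<p^ N {k} k< = m<n*o⇒m/o<n (subst (k <_) (ℕP.*-comm p (p ^ N)) k<)

  X-stable : ∀ {N N'} n → N ≤ N' → n < p ^ N → X N n ≡ X N' n
  X-stable {zero}          zero    _           _           = trans X-zero-at-zero (sym (X-at-zero _))
  X-stable {zero}          (suc n) _           (s≤s ())
  X-stable {suc N} {suc N'} n      (s≤s N≤N') n<p^N+1 = begin
    X (suc N) n                    ≡⟨ X-suc N n ⟩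
    (B ⊛ stretch (X N)) n          ≡⟨ ⊛-congʳ-upTo B n (λ k k≤n →
                                        stretch-cong-at (X N) (X N') k (X-stable (k / p) N≤N' (/p<p^ N (ℕP.≤-<-trans k≤n n<p^N+1)))) ⟩
    (B ⊛ stretch (X N')) n         ≡⟨ sym (X-suc N' n) ⟩
    X (suc N') n                   ∎
    where open ≡-Reasoning

  B≡1 : ∀ n → B n ≡ one n mod P
  B≡1 n = begin
    B n                ≈⟨ ≡mod-weaken (B≡1+pE n) ⟩
    one n + P * E n    ≈⟨ +-congˡ-≡mod (one n) (*-multiple-≡mod (E n)) ⟩
    one n + + 0        ≡⟨ ℤP.+-identityʳ (one n) ⟩
    one n              ∎
    where open ≡mod-Reasoning P

  X≡1 : ∀ N n → n < p ^ N → X N n ≡ one n mod P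
  stretch-X≡1 : ∀ N {n} → n < p ^ suc N → ∀ k → k ≤ n → stretch (X N) k ≡ one k mod P

  X≡1 zero    zero    _        = ≡⇒≡mod X-zero-at-zero
  X≡1 zero    (suc n) (s≤s ())
  X≡1 (suc N) n n<p^N+1 = begin
    X (suc N) n               ≡⟨ X-suc N n ⟩
    (B ⊛ stretch (X N)) n     ≈⟨ ⊛-cong-≡mod B one (stretch (X N)) one n (λ k _ → B≡1 k) (stretch-X≡1 N n<p^N+1) ⟩
    (one ⊛ one) n             ≡⟨ ⊛-identityˡ one n ⟩
    one n                     ∎
    where open ≡mod-Reasoning P

  stretch-X≡1 N n< k k≤n = ≡mod-trans (stretch-cong-≡mod (X N) one k (X≡1 N (k / p) (/p<p^ N (ℕP.≤-<-trans k≤n n<))))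
                                      (≡⇒≡mod (stretch-one k))

  X-suc≡ : ∀ N n → n < p ^ suc N → X (suc N) n ≡ stretch (X N) n + P * E n mod P * P
  X-suc≡ N n n< = begin
    X (suc N) n                            ≡⟨ X-suc N n ⟩
    (B ⊛ Y) n                              ≈⟨ ⊛-cong-≡mod B (one ⊕ P · E) Y Y n (λ k _ → B≡1+pE k) (λ _ _ → ≡mod-refl) ⟩
    ((one ⊕ P · E) ⊛ Y) n                  ≡⟨ ⊛-distribʳ-⊕ Y one (P · E) n ⟩
    (one ⊛ Y) n + ((P · E) ⊛ Y) n          ≡⟨ cong₂ _+_ (⊛-identityˡ Y n) (⊛-·-assocˡ P E Y n) ⟩
    Y n + P * (E ⊛ Y) n                    ≈⟨ +-congˡ-≡mod (Y n)
                                                (*-scale-≡mod P (⊛-cong-≡mod E E Y one n (λ _ _ → ≡mod-refl) (stretch-X≡1 N n<))) ⟩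
    Y n + P * (E ⊛ one) n                  ≡⟨ cong (λ t → Y n + P * t) (⊛-identityʳ E n) ⟩
    Y n + P * E n                          ∎
    where
    open ≡mod-Reasoning (P * P)
    Y = stretch (X N)

  E-periodic-* : ∀ m r → E (r ℕ.+ m ℕ.* p) ≡ E r mod P
  E-periodic-* zero    r = ≡⇒≡mod (cong E (ℕP.+-identityʳ r))
  E-periodic-* (suc m) r = begin
    E (r ℕ.+ (p ℕ.+ m ℕ.* p))    ≡⟨ cong E (trans (cong (r ℕ.+_) (ℕP.+-comm p (m ℕ.* p))) (sym (ℕP.+-assoc r (m ℕ.* p) p))) ⟩
    E (r ℕ.+ m ℕ.* p ℕ.+ p)      ≈⟨ E-periodic (r ℕ.+ m ℕ.* p) ⟩
    E (r ℕ.+ m ℕ.* p)            ≈⟨ E-periodic-* m r ⟩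
    E r                          ∎
    where open ≡mod-Reasoning P

  ≤*p⇒<p^ : ∀ m {n} → n ≤ suc m ℕ.* p → n < p ^ suc (suc m)
  ≤*p⇒<p^ m {n} n≤ = begin-strict
    n                  ≤⟨ n≤ ⟩
    suc m ℕ.* p        <⟨ ℕP.*-monoˡ-< p (n<p^n 2≤p (suc m)) ⟩
    p ^ suc m ℕ.* p    ≡⟨ ℕP.*-comm (p ^ suc m) p ⟩
    p ^ suc (suc m)    ∎
    where open ℕP.≤-Reasoning

  coefficient : Series
  coefficient n = X (suc n) n

  coefficient-at-multiple : ∀ m → coefficient (suc m ℕ.* p) ≡ coefficient (suc m) mod P * P
  coefficient-at-multiple m = begin
    X (suc n) n                                        ≡⟨ sym (X-stable n (s≤s (ℕP.m≤m*n (suc m) p)) (≤*p⇒<p^ m ℕP.≤-refl)) ⟩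
    X (suc (suc m)) n                                  ≈⟨ X-suc≡ (suc m) n (≤*p⇒<p^ m ℕP.≤-refl) ⟩
    stretch (X (suc m)) n + P * E n                    ≈⟨ +-cong-≡mod (≡⇒≡mod (stretch-at-multiple (X (suc m)) (suc m)))
                                                            (≡mod-trans (*-scale-≡mod P (≡mod-trans (E-periodic-* (suc m) 0) E-at-zero))
                                                                        (≡⇒≡mod (ℤP.*-zeroʳ P))) ⟩
    X (suc m) (suc m) + + 0                            ≡⟨ ℤP.+-identityʳ _ ⟩
    X (suc m) (suc m)                                  ≡⟨ X-stable (suc m) (ℕP.n≤1+n (suc m)) (n<p^n 2≤p (suc m)) ⟩
    X (suc (suc m)) (suc m)                            ∎
    where
    open ≡mod-Reasoning (P * P)
    n = suc m ℕ.* p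

  coefficient-at-offset : ∀ m r → 0 < r → r < p → coefficient (r ℕ.+ m ℕ.* p) ≡ coefficient r mod P * P
  coefficient-at-offset m r 0<r r<p = begin
    X (suc n) n                                        ≡⟨ sym (X-stable n (s≤s (ℕP.+-mono-≤ 0<r (ℕP.m≤m*n m p))) n<) ⟩
    X (suc (suc m)) n                                  ≈⟨ X-suc≡ (suc m) n n< ⟩
    stretch (X (suc m)) n + P * E n                    ≡⟨ cong (_+ P * E n) (stretch-off (X (suc m)) m r 0<r r<p) ⟩
    + 0 + P * E n                                      ≈⟨ +-congˡ-≡mod (+ 0) (*-scale-≡mod P (E-periodic-* m r)) ⟩
    + 0 + P * E r                                      ≡⟨ cong (_+ P * E r) (sym (stretch-below (X 0) r 0<r r<p)) ⟩
    stretch (X 0) r + P * E r                          ≈⟨ X-suc≡ 0 r r<p^1 ⟨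
    X 1 r                                              ≡⟨ X-stable r (s≤s z≤n) r<p^1 ⟩
    X (suc r) r                                        ∎
    where
    open ≡mod-Reasoning (P * P)
    n = r ℕ.+ m ℕ.* p
    n< : n < p ^ suc (suc m)
    n< = ≤*p⇒<p^ m (ℕP.+-monoˡ-≤ (m ℕ.* p) (ℕP.<⇒≤ r<p))
    r<p^1 : r < p ^ 1
    r<p^1 = subst (r <_) (sym (ℕP.*-identityʳ p)) r<p

periodic-mod : ∀ {M} q .{{_ : ℕ.NonZero q}} V W → (∀ k → V k ≡ lin q k mod M) →
               (∀ n → (V ⊛ W) (n ℕ.+ q) ≡ + 0 mod M) → ∀ n → W (n ℕ.+ q) ≡ W n mod M
periodic-mod {M} q V W V≡lin V⊛W≡0 n = begin
  W (n ℕ.+ q)                          ≡⟨ split (W (n ℕ.+ q)) (W n) ⟩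
  W (n ℕ.+ q) - W n + W n              ≡⟨ cong (λ m → W (n ℕ.+ q) - W m + W n) (sym (ℕP.m+n∸n≡m n q)) ⟩
  W (n ℕ.+ q) - W (n ℕ.+ q ∸ q) + W n  ≡⟨ cong (_+ W n) (sym (lin-⊛-≥ q W (n ℕ.+ q) (ℕP.m≤n+m q n))) ⟩
  (lin q ⊛ W) (n ℕ.+ q) + W n          ≈⟨ +-cong-≡mod (⊛-cong-≡mod (lin q) V W W (n ℕ.+ q) (λ k _ → ≡mod-sym (V≡lin k))
                                                                                           (λ _ _ → ≡mod-refl))
                                                      (≡mod-refl {a = W n}) ⟩
  (V ⊛ W) (n ℕ.+ q) + W n              ≈⟨ +-cong-≡mod (V⊛W≡0 n) (≡mod-refl {a = W n}) ⟩
  + 0 + W n                            ≡⟨ ℤP.+-identityˡ (W n) ⟩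
  W n                                  ∎
  where
  open ≡mod-Reasoning M
  split : ∀ a b → a ≡ a - b + b
  split = solve-∀

module StretchedProduct (p : ℕ) {{p≢0 : ℕ.NonZero p}} (A : ℕ → Series)
  (stretch-A : ∀ i → Stretch.stretch p (A i) ≗ A (suc i)) (e : ℕ) where

  open Stretch p

  Π : ℕ → Series
  Π = prodBelow (λ i → pow (A i) e)

  X : ℕ → Series
  X N = A 0 ⊛ Π N

  Π-suc : ∀ N → Π (suc N) ≗ pow (A 0) e ⊛ stretch (Π N)
  Π-suc zero    n = ⊛-congʳ (pow (A 0) e) (λ k → sym (stretch-one k)) n
  Π-suc (suc N) n = begin
    (pow (A (suc N)) e ⊛ Π (suc N)) n                        ≡⟨ ⊛-congʳ (pow (A (suc N)) e) (Π-suc N) n ⟩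
    (pow (A (suc N)) e ⊛ (pow (A 0) e ⊛ stretch (Π N))) n    ≡⟨ ⊛-lcomm (pow (A (suc N)) e) (pow (A 0) e) (stretch (Π N)) n ⟩
    (pow (A 0) e ⊛ (pow (A (suc N)) e ⊛ stretch (Π N))) n    ≡⟨ ⊛-congʳ (pow (A 0) e) (λ k → sym (stretch-factor k)) n ⟩
    (pow (A 0) e ⊛ stretch (Π (suc N))) n                    ∎
    where
    open ≡-Reasoning
    stretch-factor : stretch (Π (suc N)) ≗ pow (A (suc N)) e ⊛ stretch (Π N)
    stretch-factor k = trans (stretch-⊛ (pow (A N) e) (Π N) k)
                             (⊛-congˡ (stretch (Π N)) (λ j → trans (stretch-pow (A N) e j) (pow-cong e (stretch-A N) j)) k)

  X-suc : ∀ {Binv} → Binv ⊛ A 1 ≗ one → ∀ N → X (suc N) ≗ (pow (A 0) (suc e) ⊛ Binv) ⊛ stretch (X N)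
  X-suc {Binv} Binv⊛A₁≗1 N n = begin
    (A 0 ⊛ Π (suc N)) n                          ≡⟨ ⊛-congʳ (A 0) (Π-suc N) n ⟩
    (A 0 ⊛ (pow (A 0) e ⊛ stretch (Π N))) n      ≡⟨ sym (⊛-assoc (A 0) (pow (A 0) e) (stretch (Π N)) n) ⟩
    (G ⊛ stretch (Π N)) n                        ≡⟨ ⊛-congʳ G (λ k → sym (⊛-identityˡ (stretch (Π N)) k)) n ⟩
    (G ⊛ (one ⊛ stretch (Π N))) n                ≡⟨ ⊛-congʳ G (⊛-congˡ (stretch (Π N)) (λ k → sym (Binv⊛A₁≗1 k))) n ⟩
    (G ⊛ ((Binv ⊛ A 1) ⊛ stretch (Π N))) n       ≡⟨ ⊛-congʳ G (⊛-assoc Binv (A 1) (stretch (Π N))) n ⟩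
    (G ⊛ (Binv ⊛ (A 1 ⊛ stretch (Π N)))) n       ≡⟨ sym (⊛-assoc G Binv (A 1 ⊛ stretch (Π N)) n) ⟩
    ((G ⊛ Binv) ⊛ (A 1 ⊛ stretch (Π N))) n       ≡⟨ ⊛-congʳ (G ⊛ Binv) (λ k → sym (stretch-X k)) n ⟩
    ((G ⊛ Binv) ⊛ stretch (X N)) n               ∎
    where
    open ≡-Reasoning
    G = pow (A 0) (suc e)
    stretch-X : stretch (X N) ≗ A 1 ⊛ stretch (Π N)
    stretch-X k = trans (stretch-⊛ (A 0) (Π N) k) (⊛-congˡ (stretch (Π N)) (stretch-A 0) k)

module OddPrime (p′ : ℕ) (p-prime : Prime (suc p′)) (3≤p : 3 ≤ suc p′) where

  p : ℕ
  p = suc p′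

  P : ℤ
  P = + p

  open Stretch p
  open PowLinRemainder (powLinRemainder p-prime 3≤p)

  2≤p : 2 ≤ p
  2≤p = ℕP.≤-trans (s≤s (s≤s z≤n)) 3≤p

  c : Series
  c = pow (lin 1) p

  c≡lin : ∀ n → c n ≡ lin p n mod P
  c≡lin n = by (R n) (pow-lin1≡lin+pR n)

  p^1≡p : p ^ 1 ≡ p
  p^1≡p = ℕP.*-identityʳ p

  module Y where

    open StretchedProduct p (λ i → geom (p ^ i)) (λ i → stretch-geom (p ^ i)) p′ public

    G : Series
    G = pow (geom 1) p

    B : Series
    B = G ⊛ lin p

    E : Series
    E n = - (G ⊛ R) n

    G⊛c≗1 : G ⊛ c ≗ one
    G⊛c≗1 = pow-inverse (geom 1) (lin 1) p (geom-⊛-lin 1)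

    lin⊛geom : lin p ⊛ geom (p ^ 1) ≗ one
    lin⊛geom = subst (λ q → lin p ⊛ geom q ≗ one) (sym p^1≡p) (lin-⊛-geom p)

    lin≗c-pR : lin p ≗ c ⊕ (- P) · R
    lin≗c-pR n = trans (move (lin p n) (R n) P) (cong (_+ - P * R n) (sym (pow-lin1≡lin+pR n)))
      where
      move : ∀ l r q → l ≡ l + r * q + - q * r
      move = solve-∀

    B≡1+pE : ∀ n → B n ≡ one n + P * E n mod P * P
    B≡1+pE n = ≡⇒≡mod (begin
      (G ⊛ lin p) n                          ≡⟨ ⊛-congʳ G lin≗c-pR n ⟩
      (G ⊛ (c ⊕ (- P) · R)) n                ≡⟨ ⊛-distribˡ-⊕ G c ((- P) · R) n ⟩
      (G ⊛ c) n + (G ⊛ ((- P) · R)) n        ≡⟨ cong₂ _+_ (G⊛c≗1 n) (⊛-·-assocʳ (- P) G R n) ⟩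
      one n + - P * (G ⊛ R) n                ≡⟨ cong (_+_ (one n)) (neg-swap P ((G ⊛ R) n)) ⟩
      one n + P * E n                        ∎)
      where
      open ≡-Reasoning
      neg-swap : ∀ a x → - a * x ≡ a * - x
      neg-swap = solve-∀

    c⊛G⊛R≗R : c ⊛ (G ⊛ R) ≗ R
    c⊛G⊛R≗R m = begin
      (c ⊛ (G ⊛ R)) m     ≡⟨ sym (⊛-assoc c G R m) ⟩
      ((c ⊛ G) ⊛ R) m     ≡⟨ ⊛-congˡ R (λ k → trans (⊛-comm c G k) (G⊛c≗1 k)) m ⟩
      (one ⊛ R) m         ≡⟨ ⊛-identityˡ R m ⟩
      R m                 ∎
      where open ≡-Reasoning

    E-periodic : ∀ n → E (n ℕ.+ p) ≡ E n mod P
    E-periodic n = neg-cong-≡mod (periodic-mod p c (G ⊛ R) c≡lin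
      (λ n → ≡⇒≡mod (trans (c⊛G⊛R≗R (n ℕ.+ p)) (R-above (n ℕ.+ p) (ℕP.m≤n+m p n)))) n)

    E-at-zero : E 0 ≡ + 0 mod P
    E-at-zero = ≡⇒≡mod (cong -_ (trans (⊛-at-zero G R) (trans (cong (G 0 *_) R-at-zero) (ℤP.*-zeroʳ (G 0)))))

    B-at-zero : B 0 ≡ + 1
    B-at-zero = trans (⊛-at-zero G (lin p)) (cong (_* + 1) (pow-at-zero (geom 1) p refl))

    open StretchRecursion p 2≤p X B E (X-suc lin⊛geom) refl B-at-zero B≡1+pE E-periodic E-at-zero public

  module Z where

    open StretchedProduct p (λ i → lin (p ^ i)) (λ i → stretch-lin (p ^ i) {{ℕP.m^n≢0 p i}}) p′ public

    B : Series
    B = c ⊛ geom p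

    E : Series
    E = R ⊛ geom p

    geom⊛lin : geom p ⊛ lin (p ^ 1) ≗ one
    geom⊛lin = subst (λ q → geom p ⊛ lin q ≗ one) (sym p^1≡p) (geom-⊛-lin p)

    B≡1+pE : ∀ n → B n ≡ one n + P * E n mod P * P
    B≡1+pE n = ≡⇒≡mod (begin
      (c ⊛ geom p) n                              ≡⟨ ⊛-congˡ (geom p) c≗lin+pR n ⟩
      ((lin p ⊕ P · R) ⊛ geom p) n                ≡⟨ ⊛-distribʳ-⊕ (geom p) (lin p) (P · R) n ⟩
      (lin p ⊛ geom p) n + ((P · R) ⊛ geom p) n   ≡⟨ cong₂ _+_ (lin-⊛-geom p n) (⊛-·-assocˡ P R (geom p) n) ⟩
      one n + P * E n                             ∎)
      where
      open ≡-Reasoning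
      c≗lin+pR : c ≗ lin p ⊕ P · R
      c≗lin+pR k = trans (pow-lin1≡lin+pR k) (cong (_+_ (lin p k)) (ℤP.*-comm (R k) P))

    lin⊛E≗R : lin p ⊛ E ≗ R
    lin⊛E≗R m = begin
      (lin p ⊛ (R ⊛ geom p)) m      ≡⟨ ⊛-lcomm (lin p) R (geom p) m ⟩
      (R ⊛ (lin p ⊛ geom p)) m      ≡⟨ ⊛-congʳ R (lin-⊛-geom p) m ⟩
      (R ⊛ one) m                   ≡⟨ ⊛-identityʳ R m ⟩
      R m                           ∎
      where open ≡-Reasoning

    E-periodic : ∀ n → E (n ℕ.+ p) ≡ E n mod P
    E-periodic = periodic-mod p (lin p) E (λ _ → ≡mod-refl)
      (λ n → ≡⇒≡mod (trans (lin⊛E≗R (n ℕ.+ p)) (R-above (n ℕ.+ p) (ℕP.m≤n+m p n))))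

    E-at-zero : E 0 ≡ + 0 mod P
    E-at-zero = ≡⇒≡mod (trans (⊛-at-zero R (geom p)) (cong (_* geom p 0) R-at-zero))

    B-at-zero : B 0 ≡ + 1
    B-at-zero = trans (⊛-at-zero c (geom p)) (cong₂ _*_ (pow-lin1-at-zero p) (geom-< p 0 (s≤s z≤n)))

    open StretchRecursion p 2≤p X B E (X-suc geom⊛lin) refl B-at-zero B≡1+pE E-periodic E-at-zero public

  y-at-multiple : ∀ m → y p (suc m ℕ.* p) ≡ y p (suc m)
  y-at-multiple m = resDiv-cong p (Y.coefficient-at-multiple m)

  y-at-offset : ∀ m r → 0 < r → r < p → y p (r ℕ.+ m ℕ.* p) ≡ y p r
  y-at-offset m r 0<r r<p = resDiv-cong p (Y.coefficient-at-offset m r 0<r r<p)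

  z-at-multiple : ∀ m → z p (suc m ℕ.* p) ≡ z p (suc m)
  z-at-multiple m = resDiv-cong p (Z.coefficient-at-multiple m)

  z-at-offset : ∀ m r → 0 < r → r < p → z p (r ℕ.+ m ℕ.* p) ≡ z p r
  z-at-offset m r 0<r r<p = resDiv-cong p (Z.coefficient-at-offset m r 0<r r<p)

automatic₁-criterion : ∀ {A : Set} p .{{_ : ℕ.NonZero p}} (e : ℕ → A) →
  (∀ m → e (suc m ℕ.* p) ≡ e (suc m)) →
  (∀ m r → 0 < r → r < p → e (r ℕ.+ m ℕ.* p) ≡ e r) →
  IsAutomatic₁ p e
automatic₁-criterion {A} p e at-multiple at-offset = kernel , λ i j j<p^i →
  Any.map (λ e≡s n → trans (cong e (sym (ℕP.+-suc (p ^ i ℕ.* n) j))) (e≡s n)) (member i (suc j) (s≤s z≤n) j<p^i)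
  where
  kernel : List (ℕ → A)
  kernel = (λ n → e (suc n)) ∷ map (λ r _ → e r) (upTo p)

  Represented : ℕ → ℕ → Set
  Represented i c = Any (λ s → ∀ n → e (p ^ i ℕ.* n ℕ.+ c) ≡ s n) kernel

  constant : ∀ i c r → r < p → (∀ n → e (p ^ i ℕ.* n ℕ.+ c) ≡ e r) → Represented i c
  constant i c r r<p e≡ = there (map⁺ (lose (∈-upTo⁺ r<p) e≡))

  member : ∀ i c → 0 < c → c ≤ p ^ i → Represented i c
  member zero    (suc zero) _   _       = here (λ n → cong e (trans (ℕP.+-comm (1 ℕ.* n) 1) (cong suc (ℕP.*-identityˡ n))))
  member zero    (suc (suc _)) _ (s≤s ())
  member (suc i) c          0<c c≤p^i+1 with c % p in c%p | m≡m%n+[m/n]*n c p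
  ... | suc r | c≡ = constant (suc i) c (suc r) (subst (_< p) c%p (m%n<n c p))
    (λ n → trans (cong e (trans (cong (p ^ suc i ℕ.* n ℕ.+_) c≡) (regroup p (p ^ i) n (suc r) (c / p))))
                 (at-offset (p ^ i ℕ.* n ℕ.+ c / p) (suc r) (s≤s z≤n) (subst (_< p) c%p (m%n<n c p))))
    where
    regroup : ∀ p q n r m → p ℕ.* q ℕ.* n ℕ.+ (r ℕ.+ m ℕ.* p) ≡ r ℕ.+ (q ℕ.* n ℕ.+ m) ℕ.* p
    regroup = ℕ-Solver.solve-∀
  ... | zero  | c≡ = multiple (c / p) c≡
    where
    regroup : ∀ p q n m → p ℕ.* q ℕ.* n ℕ.+ (1 ℕ.+ m) ℕ.* p ≡ (1 ℕ.+ (q ℕ.* n ℕ.+ m)) ℕ.* p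
    regroup = ℕ-Solver.solve-∀
    multiple : ∀ m → c ≡ 0 ℕ.+ m ℕ.* p → Represented (suc i) c
    multiple zero    refl = ⊥-elim (ℕP.<-irrefl refl 0<c)
    multiple (suc m) refl = Any.map (λ e≡s n → trans (shift n) (e≡s n)) (member i (suc m) (s≤s z≤n) m<p^i)
      where
      m<p^i : suc m ≤ p ^ i
      m<p^i = ℕP.*-cancelʳ-≤ (suc m) (p ^ i) p (subst (suc m ℕ.* p ≤_) (ℕP.*-comm p (p ^ i)) c≤p^i+1)
      shift : ∀ n → e (p ^ suc i ℕ.* n ℕ.+ suc m ℕ.* p) ≡ e (p ^ i ℕ.* n ℕ.+ suc m)
      shift n = trans (cong e (regroup p (p ^ i) n m))
                      (trans (at-multiple (p ^ i ℕ.* n ℕ.+ m)) (cong e (sym (ℕP.+-suc (p ^ i ℕ.* n) m))))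

theorem4p1 : (p : ℕ) → Prime p → 3 ≤ p →
    IsAutomatic₁ p (y p) × IsAutomatic₁ p (z p)
theorem4p1 (suc p′) p-prime 3≤p =
  automatic₁-criterion p (y p) y-at-multiple y-at-offset ,
  automatic₁-criterion p (z p) z-at-multiple z-at-offset
  where open OddPrime p′ p-prime 3≤p
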